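{- Let $m\geq 2$ and let $r_1,r_2\geq 0$ be integers with $r_1+r_2\leq m-2$. Associate to each pair $1\leq i<j\leq m$ the vector $\binom00$ if $1\leq i<j\leq r_1+1$, the vector $\binom11$ if $m-r_2\leq i<j\leq m$, and the vector $\binom01$ otherwise. Say a column $v\in\{0,1,2\}^m$ has a mark at $(i,j)$ if $(v_i,v_j)$ equals the vector associated with $(i,j)$. Then exactly $2^m+m2^{m-1}$ columns $v\in\{0,1,2\}^m$ have no mark. -}

module Defs where

open import Data.Nat using (ℕ; zero; suc; _+_; _∸_; _≤_; _<_; _≤?_; _<?_)
open import Data.Fin using (Fin; toℕ)
open import Data.Fin.Properties using (all?; any?)
open import Data.Vec using (Vec; []; _∷_; lookup)
open import Data.List using (List; []; _∷_; concatMap; map; filter; length)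
open import Data.Product using (_×_; _,_; Σ; ∃)
open import Relation.Nullary using (¬_; Dec; yes; no)
open import Relation.Nullary.Decidable using (_×-dec_; _→-dec_; ¬?)
open import Relation.Binary.PropositionalEquality using (_≡_)
import Data.Fin.Properties as FinP

-- Entries are in {0,1,2}, represented by Fin 3.
-- Positions 1..m are represented by Fin m, position p ↔ toℕ p + 1.

-- The vector associated with the pair (i,j), i < j (1-based positions a = i, b = j):
--   (0,0) if j ≤ r₁ + 1 ; (1,1) if m - r₂ ≤ i ; (0,1) otherwise.
-- (Under r₁ + r₂ ≤ m - 2 the first two cases are disjoint.)
assoc : (m r₁ r₂ : ℕ) → (i j : ℕ) → Fin 3 × Fin 3
assoc m r₁ r₂ i j with j ≤? suc r₁
... | yes _ = (Fin.zero , Fin.zero)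
... | no _ with m ∸ r₂ ≤? i
...   | yes _ = (Fin.suc Fin.zero , Fin.suc Fin.zero)
...   | no _ = (Fin.zero , Fin.suc Fin.zero)

Column : ℕ → Set
Column m = Vec (Fin 3) m

MarkAt : (m r₁ r₂ : ℕ) → Column m → Fin m → Fin m → Set
MarkAt m r₁ r₂ v i j =
  toℕ i < toℕ j × (lookup v i , lookup v j) ≡ assoc m r₁ r₂ (suc (toℕ i)) (suc (toℕ j))

NoMark : (m r₁ r₂ : ℕ) → Column m → Set
NoMark m r₁ r₂ v = ∀ i j → ¬ MarkAt m r₁ r₂ v i j

allFinL : (n : ℕ) → List (Fin n)
allFinL zero = []
allFinL (suc n) = Fin.zero ∷ map Fin.suc (allFinL n)

allColumns : (m : ℕ) → List (Column m)
allColumns zero = [] ∷ []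
allColumns (suc m) = concatMap (λ x → map (x ∷_) (allColumns m)) (allFinL 3)

private
  pairDec : (p q : Fin 3 × Fin 3) → Dec (p ≡ q)
  pairDec (a , b) (c , d) with a FinP.≟ c | b FinP.≟ d
  ... | yes _≡_.refl | yes _≡_.refl = yes _≡_.refl
  ... | no ne | _ = no λ { _≡_.refl → ne _≡_.refl }
  ... | yes _ | no ne = no λ { _≡_.refl → ne _≡_.refl }

markAt? : (m r₁ r₂ : ℕ) (v : Column m) (i j : Fin m) → Dec (MarkAt m r₁ r₂ v i j)
markAt? m r₁ r₂ v i j =
  (toℕ i <? toℕ j) ×-dec pairDec _ _

noMark? : (m r₁ r₂ : ℕ) (v : Column m) → Dec (NoMark m r₁ r₂ v)
noMark? m r₁ r₂ v = all? λ i → all? λ j → ¬? (markAt? m r₁ r₂ v i j)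

countNoMark : (m r₁ r₂ : ℕ) → ℕ
countNoMark m r₁ r₂ = length (filter (noMark? m r₁ r₂) (allColumns m))

{-# OPTIONS --safe #-}
-- Since r₁ < m − r₂, no pair (i, j) lies in both the (0,0)-block and the (1,1)-block, so the
-- vector associated with (i, j) splits as (a i , b j), with a depending only on i and b only
-- on j.  A column v then has no mark iff every position j after the first position i with
-- v i = a i satisfies v j ≠ b j.  Classifying columns by that first position: if there is
-- none, each entry has 2 admissible values (2^m columns); if it is k, position k is forced and
-- every other position has 2 admissible values (2^(m−1) columns for each of the m choices of k).
module Submission where

open import Defs
open import Data.Nat using (ℕ; zero; suc; _+_; _*_; _∸_; _^_; _≤_; _<_; _≤?_; s≤s; z≤n)
open import Data.Nat.Properties
  using (<⇒≱; ≤-pred; ≤-<-trans; <-≤-trans; *-distribˡ-+; *-assoc; *-comm; m+n≤o⇒m≤o∸n; ∸-monoʳ-<; +-commutativeSemigroup)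
open import Data.Nat.ListAction using (sum)
open import Algebra.Properties.CommutativeSemigroup +-commutativeSemigroup using (x∙yz≈y∙xz)
open import Data.Fin as Fin using (Fin; zero; suc; toℕ)
open import Data.Fin.Properties using (all?; _≟_)
open import Data.Vec using (_∷_; lookup)
open import Data.List using (List; []; _∷_; filter; length; map; concatMap; _++_)
open import Data.List.Properties using (filter-++; filter-≐; filter-none; length-++; map-cong)
open import Data.List.Relation.Unary.All using (universal)
open import Data.Product using (_,_; proj₁; proj₂)
open import Data.Bool using (true; false)
open import Data.Empty using (⊥-elim)
open import Function using (_∘_)
open import Level using (0ℓ)
open import Relation.Nullary using (¬_; yes; no; does)
open import Relation.Nullary.Decidable using (_→-dec_; ¬?)
open import Relation.Unary using (Pred; Decidable; _≐_)
open import Relation.Binary.PropositionalEquality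
  using (_≡_; _≢_; refl; sym; trans; cong; cong₂; module ≡-Reasoning)

open ≡-Reasoning

module _ {A B : Set} {P : Pred B 0ℓ} (P? : Decidable P) where

  length-filter-map : (f : A → B) (xs : List A) →
    length (filter P? (map f xs)) ≡ length (filter (P? ∘ f) xs)
  length-filter-map f [] = refl
  length-filter-map f (x ∷ xs) with does (P? (f x))
  ... | true = cong suc (length-filter-map f xs)
  ... | false = length-filter-map f xs

  length-filter-concatMap : (f : A → List B) (xs : List A) →
    length (filter P? (concatMap f xs)) ≡ sum (map (length ∘ filter P? ∘ f) xs)
  length-filter-concatMap f [] = refl
  length-filter-concatMap f (x ∷ xs) = begin
    length (filter P? (f x ++ concatMap f xs))
      ≡⟨ cong length (filter-++ P? (f x) (concatMap f xs)) ⟩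
    length (filter P? (f x) ++ filter P? (concatMap f xs))
      ≡⟨ length-++ (filter P? (f x)) ⟩
    length (filter P? (f x)) + length (filter P? (concatMap f xs))
      ≡⟨ cong (length (filter P? (f x)) +_) (length-filter-concatMap f xs) ⟩
    sum (map (length ∘ filter P? ∘ f) (x ∷ xs)) ∎

countColumns : {n : ℕ} {P : Pred (Column n) 0ℓ} → Decidable P → ℕ
countColumns {n} P? = length (filter P? (allColumns n))

countColumns-cong : {n : ℕ} {P Q : Pred (Column n) 0ℓ} (P? : Decidable P) (Q? : Decidable Q) →
  P ≐ Q → countColumns P? ≡ countColumns Q?
countColumns-cong {n} P? Q? P≐Q = cong length (filter-≐ P? Q? P≐Q (allColumns n))

countColumns-empty : {n : ℕ} {P : Pred (Column n) 0ℓ} (P? : Decidable P) → (∀ v → ¬ P v) → countColumns P? ≡ 0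
countColumns-empty {n} P? ¬P = cong length (filter-none P? (universal ¬P (allColumns n)))

countColumns-∷ : {n : ℕ} {P : Pred (Column (suc n)) 0ℓ} (P? : Decidable P) →
  countColumns P? ≡ sum (map (λ x → countColumns (P? ∘ (x ∷_))) (allFinL 3))
countColumns-∷ {n} P? = begin
  length (filter P? (concatMap (λ x → map (x ∷_) (allColumns n)) (allFinL 3)))
    ≡⟨ length-filter-concatMap P? (λ x → map (x ∷_) (allColumns n)) (allFinL 3) ⟩
  sum (map (λ x → length (filter P? (map (x ∷_) (allColumns n)))) (allFinL 3))
    ≡⟨ cong sum (map-cong (λ x → length-filter-map P? (x ∷_) (allColumns n)) (allFinL 3)) ⟩
  sum (map (λ x → countColumns (P? ∘ (x ∷_))) (allFinL 3)) ∎

sum-allFin3-except : (c : Fin 3) (g : Fin 3 → ℕ) {a b : ℕ} →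
  g c ≡ a → (∀ x → x ≢ c → g x ≡ b) → sum (map g (allFinL 3)) ≡ a + 2 * b
sum-allFin3-except zero g gc≡a g≡b
  rewrite gc≡a | g≡b (suc zero) (λ ()) | g≡b (suc (suc zero)) (λ ()) = refl
sum-allFin3-except (suc zero) g {a} {b} gc≡a g≡b
  rewrite gc≡a | g≡b zero (λ ()) | g≡b (suc (suc zero)) (λ ()) = x∙yz≈y∙xz b a (b + 0)
sum-allFin3-except (suc (suc zero)) g {a} {b} gc≡a g≡b
  rewrite gc≡a | g≡b zero (λ ()) | g≡b (suc zero) (λ ()) =
    trans (cong (b +_) (x∙yz≈y∙xz b a 0)) (x∙yz≈y∙xz b a (b + 0))

module _ {n : ℕ} where

  Avoids : (Fin n → Fin 3) → Pred (Column n) 0ℓ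
  Avoids b v = ∀ j → lookup v j ≢ b j

  PatternFree : (Fin n → Fin 3) → (Fin n → Fin 3) → Pred (Column n) 0ℓ
  PatternFree a b v = ∀ i j → i Fin.< j → lookup v i ≡ a i → lookup v j ≢ b j

  avoids? : (b : Fin n → Fin 3) → Decidable (Avoids b)
  avoids? b v = all? λ j → ¬? (lookup v j ≟ b j)

  patternFree? : (a b : Fin n → Fin 3) → Decidable (PatternFree a b)
  patternFree? a b v = all? λ i → all? λ j →
    i Fin.<? j →-dec (lookup v i ≟ a i →-dec ¬? (lookup v j ≟ b j))

module _ {n : ℕ} {b : Fin (suc n) → Fin 3} where

  avoids-∷-hit : ∀ w → ¬ Avoids b (b zero ∷ w)
  avoids-∷-hit w av = av zero refl

  avoids-∷-miss : ∀ {x} → x ≢ b zero → Avoids b ∘ (x ∷_) ≐ Avoids (b ∘ suc)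
  avoids-∷-miss x≢b₀ = (λ av j → av (suc j)) , λ where
    av zero → x≢b₀
    av (suc j) → av j

module _ {n : ℕ} {a b : Fin (suc n) → Fin 3} where

  patternFree-∷-hit : PatternFree a b ∘ (a zero ∷_) ≐ Avoids (b ∘ suc)
  patternFree-∷-hit = (λ pf j → pf zero (suc j) (s≤s z≤n) refl) , λ where
    av i (suc j) _ _ → av j

  patternFree-∷-miss : ∀ {x} → x ≢ a zero → PatternFree a b ∘ (x ∷_) ≐ PatternFree (a ∘ suc) (b ∘ suc)
  patternFree-∷-miss x≢a₀ = (λ pf i j i<j → pf (suc i) (suc j) (s≤s i<j)) , λ where
    pf zero j _ x≡a₀ → ⊥-elim (x≢a₀ x≡a₀)
    pf (suc i) (suc j) (s≤s i<j) → pf i j i<j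

count-avoids : ∀ {n} (b : Fin n → Fin 3) → countColumns (avoids? b) ≡ 2 ^ n
count-avoids {zero} b = refl
count-avoids {suc n} b =
  trans (countColumns-∷ (avoids? b)) (sum-allFin3-except (b zero) countWithHead hit miss)
  where
  countWithHead : Fin 3 → ℕ
  countWithHead x = countColumns (avoids? b ∘ (x ∷_))

  hit : countWithHead (b zero) ≡ 0
  hit = countColumns-empty (avoids? b ∘ (b zero ∷_)) avoids-∷-hit

  miss : ∀ x → x ≢ b zero → countWithHead x ≡ 2 ^ n
  miss x x≢b₀ = trans (countColumns-cong (avoids? b ∘ (x ∷_)) (avoids? (b ∘ suc)) (avoids-∷-miss x≢b₀))
                      (count-avoids (b ∘ suc))

double-n*2^[n∸1] : ∀ n → 2 * (n * 2 ^ (n ∸ 1)) ≡ n * 2 ^ n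
double-n*2^[n∸1] zero = refl
double-n*2^[n∸1] (suc n) = begin
  2 * (suc n * 2 ^ n) ≡⟨ sym (*-assoc 2 (suc n) (2 ^ n)) ⟩
  2 * suc n * 2 ^ n   ≡⟨ cong (_* 2 ^ n) (*-comm 2 (suc n)) ⟩
  suc n * 2 * 2 ^ n   ≡⟨ *-assoc (suc n) 2 (2 ^ n) ⟩
  suc n * 2 ^ suc n   ∎

2^n+n*2^[n∸1]-recurrence : ∀ n → 2 ^ n + 2 * (2 ^ n + n * 2 ^ (n ∸ 1)) ≡ 2 ^ suc n + suc n * 2 ^ n
2^n+n*2^[n∸1]-recurrence n = begin
  2 ^ n + 2 * (2 ^ n + n * 2 ^ (n ∸ 1))       ≡⟨ cong (2 ^ n +_) (*-distribˡ-+ 2 (2 ^ n) (n * 2 ^ (n ∸ 1))) ⟩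
  2 ^ n + (2 * 2 ^ n + 2 * (n * 2 ^ (n ∸ 1))) ≡⟨ cong (λ t → 2 ^ n + (2 * 2 ^ n + t)) (double-n*2^[n∸1] n) ⟩
  2 ^ n + (2 * 2 ^ n + n * 2 ^ n)             ≡⟨ x∙yz≈y∙xz (2 ^ n) (2 * 2 ^ n) (n * 2 ^ n) ⟩
  2 * 2 ^ n + (2 ^ n + n * 2 ^ n)             ∎

count-patternFree : ∀ {n} (a b : Fin n → Fin 3) → countColumns (patternFree? a b) ≡ 2 ^ n + n * 2 ^ (n ∸ 1)
count-patternFree {zero} a b = refl
count-patternFree {suc n} a b = begin
  countColumns (patternFree? a b)                ≡⟨ countColumns-∷ (patternFree? a b) ⟩
  sum (map countWithHead (allFinL 3))            ≡⟨ sum-allFin3-except (a zero) countWithHead hit miss ⟩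
  2 ^ n + 2 * (2 ^ n + n * 2 ^ (n ∸ 1))          ≡⟨ 2^n+n*2^[n∸1]-recurrence n ⟩
  2 ^ suc n + suc n * 2 ^ n                      ∎
  where
  countWithHead : Fin 3 → ℕ
  countWithHead x = countColumns (patternFree? a b ∘ (x ∷_))

  hit : countWithHead (a zero) ≡ 2 ^ n
  hit = trans (countColumns-cong (patternFree? a b ∘ (a zero ∷_)) (avoids? (b ∘ suc)) patternFree-∷-hit)
              (count-avoids (b ∘ suc))

  miss : ∀ x → x ≢ a zero → countWithHead x ≡ 2 ^ n + n * 2 ^ (n ∸ 1)
  miss x x≢a₀ = trans (countColumns-cong (patternFree? a b ∘ (x ∷_)) (patternFree? (a ∘ suc) (b ∘ suc))
                                         (patternFree-∷-miss x≢a₀))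
                      (count-patternFree (a ∘ suc) (b ∘ suc))

assocFst : (m r₂ p : ℕ) → Fin 3
assocFst m r₂ p with m ∸ r₂ ≤? p
... | yes _ = suc zero
... | no _ = zero

assocSnd : (r₁ q : ℕ) → Fin 3
assocSnd r₁ q with q ≤? suc r₁
... | yes _ = zero
... | no _ = suc zero

assoc-split : ∀ {m r₁ r₂ p q} → r₁ < m ∸ r₂ → p < q → assoc m r₁ r₂ p q ≡ (assocFst m r₂ p , assocSnd r₁ q)
assoc-split {m} {r₁} {r₂} {p} {q} r₁<m∸r₂ p<q with q ≤? suc r₁
... | yes q≤1+r₁ with m ∸ r₂ ≤? p
...   | yes m∸r₂≤p = ⊥-elim (<⇒≱ r₁<m∸r₂ (≤-pred (<-≤-trans (≤-<-trans m∸r₂≤p p<q) q≤1+r₁)))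
...   | no _ = refl
assoc-split {m} {r₁} {r₂} {p} {q} r₁<m∸r₂ p<q | no _ with m ∸ r₂ ≤? p
...   | yes _ = refl
...   | no _ = refl

noMark≐patternFree : ∀ {m r₁ r₂} {a b : Fin m → Fin 3} →
  (∀ {i j} → i Fin.< j → assoc m r₁ r₂ (suc (toℕ i)) (suc (toℕ j)) ≡ (a i , b j)) →
  NoMark m r₁ r₂ ≐ PatternFree a b
noMark≐patternFree split =
  (λ nm i j i<j vᵢ≡aᵢ vⱼ≡bⱼ → nm i j (i<j , trans (cong₂ _,_ vᵢ≡aᵢ vⱼ≡bⱼ) (sym (split i<j)))) ,
  (λ pf i j (i<j , mark) → let mark′ = trans mark (split i<j) in
     pf i j i<j (cong proj₁ mark′) (cong proj₂ mark′))

lemma11 : (m r₁ r₂ : ℕ) → 2 ≤ m → r₁ + r₂ ≤ m ∸ 2 →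
    countNoMark m r₁ r₂ ≡ 2 ^ m + m * 2 ^ (m ∸ 1)
lemma11 m r₁ r₂ 2≤m r₁+r₂≤m∸2 = begin
  countNoMark m r₁ r₂
    ≡⟨ countColumns-cong (noMark? m r₁ r₂) (patternFree? a b) (noMark≐patternFree (assoc-split r₁<m∸r₂ ∘ s≤s)) ⟩
  countColumns (patternFree? a b)
    ≡⟨ count-patternFree a b ⟩
  2 ^ m + m * 2 ^ (m ∸ 1) ∎
  where
  a b : Fin m → Fin 3
  a i = assocFst m r₂ (suc (toℕ i))
  b j = assocSnd r₁ (suc (toℕ j))

  r₁<m∸r₂ : r₁ < m ∸ r₂
  r₁<m∸r₂ = m+n≤o⇒m≤o∸n (suc r₁) (≤-<-trans r₁+r₂≤m∸2 (∸-monoʳ-< (s≤s z≤n) 2≤m))
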